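{- Let $h$ be a monotonically increasing function with the NS-property, and consider the stair chocolate game with a pass for $h$. Define - $A_0=\{(x,y,z,0)\mid x\oplus y\oplus z=0,\ y\le h(z)\}$; - $A_1=\{(x,y,z,1)\mid x \text{ odd},\ (x+1)\oplus y\oplus z=0,\ y\le h(z)\}$; - $A_2=\{(x,y,z,1)\mid x\ge2,\ x \text{ even},\ (x-1)\oplus y\oplus z=0,\ y\le h(z)\}$; - $A=A_0\cup A_1\cup A_2\cup\{(0,0,0,1)\}$. Here $x,y,z$ range over nonnegative integers. Then a position $(x,y,z,p)$ is in $A$ if and only if it is a $\mathcal{P}$-position.
   Context: A function $h:\mathbb{Z}_{\ge0}\to\mathbb{Z}_{\ge0}$ is monotonically increasing if $h(u)\le h(v)$ whenever $u\le v$. Such an $h$ has the NS-property if both of the following hold: - $h(0)=0$; - for all $z,z'\in\mathbb{Z}_{\ge0}$ and every positive integer $i$, $\lfloor z/2^i\rfloor=\lfloor z'/2^i\rfloor$ implies $\lfloor h(z)/2^{i-1}\rfloor=\lfloor h(z')/2^{i-1}\rfloor$. The stair chocolate game with a pass for $h$ is an impartial game under normal play (the player with no legal move loses). Its positions are $(x,y,z,p)$ with $x,y,z\in\mathbb{Z}_{\ge0}$, $y\le h(z)$ and $p\in\{0,1\}$, where $p=1$ means a pass is still available. The options of $(x,y,z,p)$ are: - $(u,y,z,p)$ for each $u<x$; - $(x,v,z,p)$ for each $v<y$; - $(x,\min(y,h(w)),w,p)$ for each $w<z$; - if $p=1$ and $(x,y,z)\ne(0,0,0)$, additionally $(x,y,z,0)$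 (the pass). A $\mathcal{P}$-position is one from which the previous player (the player who just moved) has a winning strategy. The symbol $\oplus$ denotes bitwise XOR of nonnegative integers. -}

module Defs where

open import Data.Nat using (ℕ; zero; suc; _+_; _*_; _∸_; _^_; _≤_; _<_; _%_; _/_; _⊓_; NonZero)
open import Data.Nat.Properties using (m^n≢0)
open import Data.Bool using (Bool; true; false)
open import Data.Product using (_×_; _,_)
open import Relation.Binary.PropositionalEquality using (_≡_)
open import Relation.Nullary using (¬_)

infixl 7 _/2^_
_/2^_ : ℕ → ℕ → ℕ
z /2^ i = _/_ z (2 ^ i) {{m^n≢0 2 i}}

-- Bitwise XOR on ℕ, computed bit by bit with fuel (bit length of n is ≤ n).
xorFuel : ℕ → ℕ → ℕ → ℕ
xorFuel zero    a b = 0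
xorFuel (suc f) a b = ((a % 2 + b % 2) % 2) + 2 * xorFuel f (a / 2) (b / 2)

infixl 6 _⊕_
_⊕_ : ℕ → ℕ → ℕ
a ⊕ b = xorFuel (a + b) a b

Monotone : (ℕ → ℕ) → Set
Monotone h = ∀ u v → u ≤ v → h u ≤ h v

-- NS-property (i = suc j ranges over positive integers, i - 1 = j)
NSProperty : (ℕ → ℕ) → Set
NSProperty h =
  (h 0 ≡ 0) ×
  (∀ z z' j → z /2^ suc j ≡ z' /2^ suc j → h z /2^ j ≡ h z' /2^ j)

-- Positions (x , y , z , p); p = true means a pass is still available.
Pos : Set
Pos = ℕ × ℕ × ℕ × Bool

data Move (h : ℕ → ℕ) : Pos → Pos → Set where
  move-x : ∀ {x y z p u} → u < x → Move h (x , y , z , p) (u , y , z , p)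
  move-y : ∀ {x y z p v} → v < y → Move h (x , y , z , p) (x , v , z , p)
  move-z : ∀ {x y z p w} → w < z → Move h (x , y , z , p) (x , y ⊓ h w , w , p)
  pass   : ∀ {x y z} → ¬ (x ≡ 0 × y ≡ 0 × z ≡ 0) →
           Move h (x , y , z , true) (x , y , z , false)

-- P-positions and N-positions (the game is well-founded, so the inductive
-- definitions capture exactly the normal-play P/N classification).
mutual
  data IsP (h : ℕ → ℕ) : Pos → Set where
    isP : ∀ {s} → (∀ {t} → Move h s t → IsN h t) → IsP h s

  data IsN (h : ℕ → ℕ) : Pos → Set where
    isN : ∀ {s t} → Move h s t → IsP h t → IsN h s

data InA (h : ℕ → ℕ) : Pos → Set where
  inA₀ : ∀ {x y z} → x ⊕ y ⊕ z ≡ 0 → y ≤ h z → InA h (x , y , z , false)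
  inA₁ : ∀ {x y z} → x % 2 ≡ 1 → (x + 1) ⊕ y ⊕ z ≡ 0 → y ≤ h z →
         InA h (x , y , z , true)
  inA₂ : ∀ {x y z} → 2 ≤ x → x % 2 ≡ 0 → (x ∸ 1) ⊕ y ⊕ z ≡ 0 → y ≤ h z →
         InA h (x , y , z , true)
  inA₃ : InA h (0 , 0 , 0 , true)

-- Without the pass this is Nim on (x, y, z), except that moving z to w also
-- truncates y to h w.  By the NS-property, h w /2^ j only depends on
-- w /2^ (j + 1); so if y ≤ h z and j is the highest bit where w and z differ,
-- then y ⊓ h w and y agree from bit j upwards, and the highest-bit argument of
-- Nim survives the truncation.  A z-move to a zero position is a fixed point of
-- w ↦ x ⊕ (y ⊓ h w), and such a fixed point exists because this map is
-- contracting for the metric of agreeing high bits.  With the pass available,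
-- a nonzero x behaves like the Nim heap of its twin (2k − 1 ↔ 2k): where Nim
-- would move x to its twin, the player passes instead.
module Submission where

open import Defs
open import Data.Nat
  using (ℕ; zero; suc; _+_; _*_; _^_; _≤_; _<_; _%_; _/_; _⊓_; NonZero; z≤n; s≤s; _≟_; _<?_)
open import Data.Nat.Properties
open import Data.Nat.DivMod
open import Data.Nat.Divisibility using (divides-refl)
open import Data.Nat.Induction using (<-wellFounded)
open import Induction.WellFounded using (Acc; acc)
open import Data.Bool using (Bool; true; false)
open import Data.Product using (Σ; _×_; _,_; proj₁; proj₂)
open import Data.Sum using (_⊎_; inj₁; inj₂)
open import Data.Empty using (⊥-elim)
open import Function using (_∘_)
open import Function.Bundles using (_⇔_; mk⇔)
open import Function.Construct.Composition using (_⇔-∘_)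
open import Relation.Nullary using (¬_; Dec; yes; no)
open import Relation.Nullary.Decidable using (_×-dec_; decidable-stable)
open import Relation.Binary.PropositionalEquality
open import Relation.Binary.Definitions using (tri<; tri≈; tri>)

parity : ∀ m → m % 2 ≡ 0 ⊎ m % 2 ≡ 1
parity m with m % 2 | m%n<n m 2
... | 0           | _             = inj₁ refl
... | 1           | _             = inj₂ refl
... | suc (suc _) | s≤s (s≤s ())

/2-≤ : ∀ {a n} → a ≤ suc n → a / 2 ≤ n
/2-≤ {a} {n} a≤1+n =
  ≤-pred (≤-trans (s≤s (/-monoˡ-≤ 2 a≤1+n)) (m/n<m (suc n) 2 (s≤s (s≤s z≤n))))

≡-from-%2-/2 : ∀ {a b} → a % 2 ≡ b % 2 → a / 2 ≡ b / 2 → a ≡ b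
≡-from-%2-/2 {a} {b} same-%2 same-/2 = begin
  a                  ≡⟨ m≡m%n+[m/n]*n a 2 ⟩
  a % 2 + a / 2 * 2  ≡⟨ cong₂ (λ r q → r + q * 2) same-%2 same-/2 ⟩
  b % 2 + b / 2 * 2  ≡⟨ m≡m%n+[m/n]*n b 2 ⟨
  b                  ∎
  where open ≡-Reasoning

[r+2q]%2≡r : ∀ r q → r < 2 → (r + 2 * q) % 2 ≡ r
[r+2q]%2≡r r q r<2 =
  trans (cong (λ t → (r + t) % 2) (*-comm 2 q))
        (trans ([m+kn]%n≡m%n r q 2) (m<n⇒m%n≡m r<2))

[r+2q]/2≡q : ∀ r q → r < 2 → (r + 2 * q) / 2 ≡ q
[r+2q]/2≡q r q r<2 =
  trans (cong (λ t → (r + t) / 2) (*-comm 2 q))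
        (trans (+-distrib-/-∣ʳ r (divides-refl q))
               (cong₂ _+_ (m<n⇒m/n≡0 r<2) (m*n/n≡m q 2)))

[m%2+n]%2≡[m+n]%2 : ∀ m n → (m % 2 + n) % 2 ≡ (m + n) % 2
[m%2+n]%2≡[m+n]%2 m n = begin
  (m % 2 + n) % 2          ≡⟨ %-distribˡ-+ (m % 2) n 2 ⟩
  (m % 2 % 2 + n % 2) % 2  ≡⟨ cong (λ t → (t + n % 2) % 2) (m%n%n≡m%n m 2) ⟩
  (m % 2 + n % 2) % 2      ≡⟨ %-distribˡ-+ m n 2 ⟨
  (m + n) % 2              ∎
  where open ≡-Reasoning

[m+n%2]%2≡[m+n]%2 : ∀ m n → (m + n % 2) % 2 ≡ (m + n) % 2
[m+n%2]%2≡[m+n]%2 m n = begin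
  (m + n % 2) % 2  ≡⟨ cong (_% 2) (+-comm m (n % 2)) ⟩
  (n % 2 + m) % 2  ≡⟨ [m%2+n]%2≡[m+n]%2 n m ⟩
  (n + m) % 2      ≡⟨ cong (_% 2) (+-comm n m) ⟩
  (m + n) % 2      ∎
  where open ≡-Reasoning

[n+n]%2≡0 : ∀ n → (n + n) % 2 ≡ 0
[n+n]%2≡0 n =
  trans (cong (λ t → (n + t) % 2) (sym (+-identityʳ n)))
        (trans (cong (_% 2) (*-comm 2 n)) (m*n%n≡0 n 2))

sum-of-bits-odd : ∀ {p q} → p ≡ 0 ⊎ p ≡ 1 → q ≡ 0 ⊎ q ≡ 1 → (p + q) % 2 ≡ 1 →
                  (p ≡ 1 × q ≡ 0) ⊎ (p ≡ 0 × q ≡ 1)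
sum-of-bits-odd (inj₁ refl) (inj₁ refl) ()
sum-of-bits-odd (inj₁ refl) (inj₂ refl) _ = inj₂ (refl , refl)
sum-of-bits-odd (inj₂ refl) (inj₁ refl) _ = inj₁ (refl , refl)
sum-of-bits-odd (inj₂ refl) (inj₂ refl) ()

n<2^n : ∀ n → n < 2 ^ n
n<2^n zero    = s≤s z≤n
n<2^n (suc n) =
  subst (suc (suc n) ≤_) (cong (2 ^ n +_) (sym (+-identityʳ (2 ^ n))))
        (+-mono-≤ (m^n>0 2 n) (n<2^n n))

xorFuel-0-0 : ∀ f → xorFuel f 0 0 ≡ 0
xorFuel-0-0 zero    = refl
xorFuel-0-0 (suc f) = cong (2 *_) (xorFuel-0-0 f)

xorFuel-enough : ∀ f g {a b} → a ≤ f → b ≤ f → a ≤ g → b ≤ g →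
                 xorFuel f a b ≡ xorFuel g a b
xorFuel-enough zero    zero    _   _   _   _   = refl
xorFuel-enough zero    (suc g) z≤n z≤n _   _   = sym (xorFuel-0-0 (suc g))
xorFuel-enough (suc f) zero    _   _   z≤n z≤n = xorFuel-0-0 (suc f)
xorFuel-enough (suc f) (suc g) {a} {b} a≤f b≤f a≤g b≤g =
  cong (λ t → (a % 2 + b % 2) % 2 + 2 * t)
       (xorFuel-enough f g (/2-≤ a≤f) (/2-≤ b≤f) (/2-≤ a≤g) (/2-≤ b≤g))

⊕-unfold : ∀ a b → a ⊕ b ≡ (a % 2 + b % 2) % 2 + 2 * (a / 2 ⊕ b / 2)
⊕-unfold a b = begin
  xorFuel (a + b) a b
    ≡⟨ xorFuel-enough (a + b) (suc (a + b)) a≤a+b b≤a+b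
                      (m≤n⇒m≤1+n a≤a+b) (m≤n⇒m≤1+n b≤a+b) ⟩
  xorFuel (suc (a + b)) a b
    ≡⟨ cong (λ t → (a % 2 + b % 2) % 2 + 2 * t)
            (xorFuel-enough (a + b) (a / 2 + b / 2)
               (≤-trans (m/n≤m a 2) a≤a+b) (≤-trans (m/n≤m b 2) b≤a+b)
               (m≤m+n _ _) (m≤n+m _ _)) ⟩
  (a % 2 + b % 2) % 2 + 2 * (a / 2 ⊕ b / 2)
    ∎
  where
  open ≡-Reasoning
  a≤a+b : a ≤ a + b
  a≤a+b = m≤m+n a b
  b≤a+b : b ≤ a + b
  b≤a+b = m≤n+m b a

⊕-%2 : ∀ a b → (a ⊕ b) % 2 ≡ (a % 2 + b % 2) % 2
⊕-%2 a b = trans (cong (_% 2) (⊕-unfold a b))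
                 ([r+2q]%2≡r _ (a / 2 ⊕ b / 2) (m%n<n (a % 2 + b % 2) 2))

⊕-/2 : ∀ a b → (a ⊕ b) / 2 ≡ a / 2 ⊕ b / 2
⊕-/2 a b = trans (cong (_/ 2) (⊕-unfold a b))
                 ([r+2q]/2≡q _ (a / 2 ⊕ b / 2) (m%n<n (a % 2 + b % 2) 2))

/2^-zero : ∀ a → a /2^ 0 ≡ a
/2^-zero = n/1≡n

/2^-suc : ∀ a j → a /2^ suc j ≡ (a / 2) /2^ j
/2^-suc a j = sym (m/n/o≡m/[n*o] a 2 (2 ^ j) {{_}} {{m^n≢0 2 j}} {{m^n≢0 2 (suc j)}})

/2^-sucʳ : ∀ a j → a /2^ suc j ≡ (a /2^ j) / 2
/2^-sucʳ a j =
  sym (trans (m/n/o≡m/[n*o] a (2 ^ j) 2 {{m^n≢0 2 j}} {{_}} {{nonZero}})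
             (/-congʳ {{nonZero}} {{m^n≢0 2 (suc j)}} (*-comm (2 ^ j) 2)))
  where
  nonZero : NonZero (2 ^ j * 2)
  nonZero = subst NonZero (*-comm 2 (2 ^ j)) (m^n≢0 2 (suc j))

0/2^ : ∀ j → 0 /2^ j ≡ 0
0/2^ j = 0/n≡0 (2 ^ j) {{m^n≢0 2 j}}

/2^-monoˡ-≤ : ∀ j {a b} → a ≤ b → a /2^ j ≤ b /2^ j
/2^-monoˡ-≤ j = /-monoˡ-≤ (2 ^ j) {{m^n≢0 2 j}}

/2^-distrib-⊓ : ∀ j a b → (a ⊓ b) /2^ j ≡ (a /2^ j) ⊓ (b /2^ j)
/2^-distrib-⊓ j = mono-≤-distrib-⊓ (/2^-monoˡ-≤ j)

⊕-/2^ : ∀ j a b → (a ⊕ b) /2^ j ≡ (a /2^ j) ⊕ (b /2^ j)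
⊕-/2^ zero    a b = trans (/2^-zero (a ⊕ b)) (sym (cong₂ _⊕_ (/2^-zero a) (/2^-zero b)))
⊕-/2^ (suc j) a b = begin
  (a ⊕ b) /2^ suc j              ≡⟨ /2^-suc (a ⊕ b) j ⟩
  ((a ⊕ b) / 2) /2^ j            ≡⟨ cong (_/2^ j) (⊕-/2 a b) ⟩
  (a / 2 ⊕ b / 2) /2^ j          ≡⟨ ⊕-/2^ j (a / 2) (b / 2) ⟩
  (a / 2) /2^ j ⊕ (b / 2) /2^ j  ≡⟨ cong₂ _⊕_ (/2^-suc a j) (/2^-suc b j) ⟨
  a /2^ suc j ⊕ b /2^ suc j      ∎
  where open ≡-Reasoning

bit : ℕ → ℕ → ℕ
bit j a = (a /2^ j) % 2

bit-zero : ∀ j → bit j 0 ≡ 0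
bit-zero j = cong (_% 2) (0/2^ j)

bit-⊕ : ∀ j a b → bit j (a ⊕ b) ≡ (bit j a + bit j b) % 2
bit-⊕ j a b = trans (cong (_% 2) (⊕-/2^ j a b)) (⊕-%2 (a /2^ j) (b /2^ j))

/2^-split : ∀ j a → a /2^ j ≡ bit j a + a /2^ suc j * 2
/2^-split j a =
  trans (m≡m%n+[m/n]*n (a /2^ j) 2) (cong (λ q → bit j a + q * 2) (sym (/2^-sucʳ a j)))

highest-diff : ∀ {a b} → a ≢ b →
               Σ ℕ λ j → a /2^ suc j ≡ b /2^ suc j × bit j a ≢ bit j b
highest-diff {a} {b} = go (a + b) (m≤m+n a b) (m≤n+m b a)
  where
  go : ∀ n {a b} → a ≤ n → b ≤ n → a ≢ b →
       Σ ℕ λ j → a /2^ suc j ≡ b /2^ suc j × bit j a ≢ bit j b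
  go zero    z≤n z≤n a≢b = ⊥-elim (a≢b refl)
  go (suc n) {a} {b} a≤n b≤n a≢b with a / 2 ≟ b / 2
  ... | yes halves =
    0 , halves , λ same → a≢b (≡-from-%2-/2 (subst₂ (λ r s → r % 2 ≡ s % 2)
                                                    (/2^-zero a) (/2^-zero b) same) halves)
  ... | no halves≢ with go n (/2-≤ a≤n) (/2-≤ b≤n) halves≢
  ...   | j , above , differ =
    suc j ,
    trans (/2^-suc a (suc j)) (trans above (sym (/2^-suc b (suc j)))) ,
    λ same → differ (subst₂ (λ r s → r % 2 ≡ s % 2) (/2^-suc a j) (/2^-suc b j) same)

agree-above-< : ∀ j {a b} → a /2^ suc j ≡ b /2^ suc j → bit j a ≡ 0 → bit j b ≡ 1 → a < b
agree-above-< j {a} {b} above a0 b1 with a <? b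
... | yes a<b = a<b
... | no  a≮b = ⊥-elim (<⇒≱ shifted< (/2^-monoˡ-≤ j (≮⇒≥ a≮b)))
  where
  open ≤-Reasoning
  shifted< : a /2^ j < b /2^ j
  shifted< = begin-strict
    a /2^ j                    ≡⟨ /2^-split j a ⟩
    bit j a + a /2^ suc j * 2  ≡⟨ cong₂ (λ r q → r + q * 2) a0 above ⟩
    0 + b /2^ suc j * 2        <⟨ n<1+n _ ⟩
    1 + b /2^ suc j * 2        ≡⟨ cong (λ r → r + b /2^ suc j * 2) b1 ⟨
    bit j b + b /2^ suc j * 2  ≡⟨ /2^-split j b ⟨
    b /2^ j                    ∎

highest-diff-< : ∀ {a b} → a < b →
                 Σ ℕ λ j → a /2^ suc j ≡ b /2^ suc j × bit j a ≡ 0 × bit j b ≡ 1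
highest-diff-< {a} {b} a<b with highest-diff (<⇒≢ a<b)
... | j , above , differ with parity (a /2^ j) | parity (b /2^ j)
...   | inj₁ a0 | inj₁ b0 = ⊥-elim (differ (trans a0 (sym b0)))
...   | inj₁ a0 | inj₂ b1 = j , above , a0 , b1
...   | inj₂ a1 | inj₁ b0 = ⊥-elim (<⇒≱ a<b (<⇒≤ (agree-above-< j (sym above) b0 a1)))
...   | inj₂ a1 | inj₂ b1 = ⊥-elim (differ (trans a1 (sym b1)))

≡-from-bits : ∀ {a b} → (∀ j → bit j a ≡ bit j b) → a ≡ b
≡-from-bits {a} {b} same with a ≟ b
... | yes a≡b = a≡b
... | no  a≢b with highest-diff a≢b
...   | j , _ , differ = ⊥-elim (differ (same j))

⊕-comm : ∀ a b → a ⊕ b ≡ b ⊕ a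
⊕-comm a b = ≡-from-bits λ j → begin
  bit j (a ⊕ b)            ≡⟨ bit-⊕ j a b ⟩
  (bit j a + bit j b) % 2  ≡⟨ cong (_% 2) (+-comm (bit j a) (bit j b)) ⟩
  (bit j b + bit j a) % 2  ≡⟨ bit-⊕ j b a ⟨
  bit j (b ⊕ a)            ∎
  where open ≡-Reasoning

⊕-assoc : ∀ a b c → a ⊕ b ⊕ c ≡ a ⊕ (b ⊕ c)
⊕-assoc a b c = ≡-from-bits λ j → begin
  bit j (a ⊕ b ⊕ c)                        ≡⟨ bit-⊕ j (a ⊕ b) c ⟩
  (bit j (a ⊕ b) + bit j c) % 2            ≡⟨ cong (λ t → (t + bit j c) % 2) (bit-⊕ j a b) ⟩
  ((bit j a + bit j b) % 2 + bit j c) % 2  ≡⟨ [m%2+n]%2≡[m+n]%2 (bit j a + bit j b) (bit j c) ⟩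
  (bit j a + bit j b + bit j c) % 2        ≡⟨ cong (_% 2) (+-assoc (bit j a) (bit j b) (bit j c)) ⟩
  (bit j a + (bit j b + bit j c)) % 2      ≡⟨ [m+n%2]%2≡[m+n]%2 (bit j a) (bit j b + bit j c) ⟨
  (bit j a + (bit j b + bit j c) % 2) % 2  ≡⟨ cong (λ t → (bit j a + t) % 2) (bit-⊕ j b c) ⟨
  (bit j a + bit j (b ⊕ c)) % 2            ≡⟨ bit-⊕ j a (b ⊕ c) ⟨
  bit j (a ⊕ (b ⊕ c))                      ∎
  where open ≡-Reasoning

⊕-identityʳ : ∀ a → a ⊕ 0 ≡ a
⊕-identityʳ a = ≡-from-bits λ j → begin
  bit j (a ⊕ 0)            ≡⟨ bit-⊕ j a 0 ⟩
  (bit j a + bit j 0) % 2  ≡⟨ cong (λ t → (bit j a + t) % 2) (bit-zero j) ⟩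
  (bit j a + 0) % 2        ≡⟨ cong (_% 2) (+-identityʳ (bit j a)) ⟩
  bit j a % 2              ≡⟨ m%n%n≡m%n (a /2^ j) 2 ⟩
  bit j a                  ∎
  where open ≡-Reasoning

⊕-identityˡ : ∀ a → 0 ⊕ a ≡ a
⊕-identityˡ a = trans (⊕-comm 0 a) (⊕-identityʳ a)

m⊕m≡0 : ∀ a → a ⊕ a ≡ 0
m⊕m≡0 a = ≡-from-bits λ j →
  trans (bit-⊕ j a a) (trans ([n+n]%2≡0 (bit j a)) (sym (bit-zero j)))

m⊕n⊕n≡m : ∀ a b → a ⊕ b ⊕ b ≡ a
m⊕n⊕n≡m a b = trans (⊕-assoc a b b) (trans (cong (a ⊕_) (m⊕m≡0 b)) (⊕-identityʳ a))

⊕-cancelʳ : ∀ {a b} c → a ⊕ c ≡ b ⊕ c → a ≡ b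
⊕-cancelʳ {a} {b} c eq = trans (sym (m⊕n⊕n≡m a c)) (trans (cong (_⊕ c) eq) (m⊕n⊕n≡m b c))

⊕-cancelˡ : ∀ {a b} c → c ⊕ a ≡ c ⊕ b → a ≡ b
⊕-cancelˡ {a} {b} c eq = ⊕-cancelʳ c (trans (⊕-comm a c) (trans eq (⊕-comm c b)))

m⊕n≡0⇒m≡n : ∀ {a b} → a ⊕ b ≡ 0 → a ≡ b
m⊕n≡0⇒m≡n {a} {b} eq = ⊕-cancelʳ b (trans eq (sym (m⊕m≡0 b)))

m≡n⇒m⊕n≡0 : ∀ {a b} → a ≡ b → a ⊕ b ≡ 0
m≡n⇒m⊕n≡0 {a} refl = m⊕m≡0 a

bit-⊕≡1 : ∀ j a b → bit j (a ⊕ b) ≡ 1 → (bit j a ≡ 1 × bit j b ≡ 0) ⊎ (bit j a ≡ 0 × bit j b ≡ 1)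
bit-⊕≡1 j a b odd =
  sum-of-bits-odd (parity (a /2^ j)) (parity (b /2^ j)) (trans (sym (bit-⊕ j a b)) odd)

reduce-heap : ∀ j {a y z} → z /2^ suc j ≡ (a ⊕ y) /2^ suc j →
              bit j z ≡ 0 → bit j a ≡ 1 → bit j y ≡ 0 → z ⊕ y < a
reduce-heap j {a} {y} {z} above z0 a1 y0 = agree-above-< j prefix bit0 a1
  where
  open ≡-Reasoning
  prefix : (z ⊕ y) /2^ suc j ≡ a /2^ suc j
  prefix = begin
    (z ⊕ y) /2^ suc j                        ≡⟨ ⊕-/2^ (suc j) z y ⟩
    z /2^ suc j ⊕ y /2^ suc j                ≡⟨ cong (_⊕ y /2^ suc j) above ⟩
    (a ⊕ y) /2^ suc j ⊕ y /2^ suc j          ≡⟨ cong (_⊕ y /2^ suc j) (⊕-/2^ (suc j) a y) ⟩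
    a /2^ suc j ⊕ y /2^ suc j ⊕ y /2^ suc j  ≡⟨ m⊕n⊕n≡m (a /2^ suc j) (y /2^ suc j) ⟩
    a /2^ suc j                              ∎
  bit0 : bit j (z ⊕ y) ≡ 0
  bit0 = trans (bit-⊕ j z y) (cong₂ (λ r s → (r + s) % 2) z0 y0)

nim-move : ∀ {a y z} → z < a ⊕ y →
           (Σ ℕ λ u → u < a × u ⊕ y ≡ z) ⊎ (Σ ℕ λ v → v < y × a ⊕ v ≡ z)
nim-move {a} {y} {z} z<a⊕y with highest-diff-< z<a⊕y
... | j , above , z0 , s1 with bit-⊕≡1 j a y s1
...   | inj₁ (a1 , y0) = inj₁ (z ⊕ y , reduce-heap j above z0 a1 y0 , m⊕n⊕n≡m z y)
...   | inj₂ (a0 , y1) =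
  inj₂ (z ⊕ a ,
        reduce-heap j (trans above (cong (_/2^ suc j) (⊕-comm a y))) z0 y1 a0 ,
        trans (⊕-comm a (z ⊕ a)) (m⊕n⊕n≡m z a))

-- Contracting for the metric on ℕ in which w and w′ are at distance 2^k for the
-- least k with w /2^ k ≡ w′ /2^ k.
Contracting : (ℕ → ℕ) → Set
Contracting g = ∀ w w′ j → w /2^ suc j ≡ w′ /2^ suc j → g w /2^ j ≡ g w′ /2^ j

contracting-fixpoint : ∀ {g} → Contracting g → Σ ℕ λ w → g w ≡ w
contracting-fixpoint {g} contracting = unshift (descend (g 0) top)
  where
  FixedAbove : ℕ → Set
  FixedAbove j = Σ ℕ λ w → g w /2^ j ≡ w /2^ j

  top : FixedAbove (g 0)
  top = 0 , trans (m<n⇒m/n≡0 {{m^n≢0 2 (g 0)}} (n<2^n (g 0))) (sym (0/2^ (g 0)))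

  lower : ∀ j → FixedAbove (suc j) → FixedAbove j
  lower j (w , fixed) = w′ , trans (contracting w′ w j w′≈w) (sym w′-top)
    where
    w′ : ℕ
    w′ = (g w /2^ j) * 2 ^ j
    w′-top : w′ /2^ j ≡ g w /2^ j
    w′-top = m*n/n≡m (g w /2^ j) (2 ^ j) {{m^n≢0 2 j}}
    w′≈w : w′ /2^ suc j ≡ w /2^ suc j
    w′≈w = trans (/2^-sucʳ w′ j)
                 (trans (cong (_/ 2) w′-top) (trans (sym (/2^-sucʳ (g w) j)) fixed))

  descend : ∀ j → FixedAbove j → FixedAbove 0
  descend zero    fixed = fixed
  descend (suc j) fixed = descend j (lower j fixed)

  unshift : FixedAbove 0 → Σ ℕ λ w → g w ≡ w
  unshift (w , fixed) = w , trans (sym (/2^-zero (g w))) (trans fixed (/2^-zero w))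

Legal : (ℕ → ℕ) → Pos → Set
Legal h (x , y , z , p) = y ≤ h z

Legal-closed : ∀ {h s t} → Move h s t → Legal h s → Legal h t
Legal-closed (move-x _)                    legal = legal
Legal-closed (move-y v<y)                  legal = ≤-trans (<⇒≤ v<y) legal
Legal-closed {h} (move-z {y = y} {w = w} _) _     = m⊓n≤n y (h w)
Legal-closed (pass _)                      legal = legal

weight : Pos → ℕ
weight (x , y , z , false) = x + y + z
weight (x , y , z , true)  = suc (x + y + z)

weight-< : ∀ {x y z x′ y′ z′} → x′ + y′ + z′ < x + y + z →
           ∀ p → weight (x′ , y′ , z′ , p) < weight (x , y , z , p)
weight-< lt false = lt
weight-< lt true  = s≤s lt

weight-decreasing : ∀ {h s t} → Move h s t → weight t < weight s
weight-decreasing {s = x , y , z , p} (move-x u<x) =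
  weight-< (+-monoˡ-< z (+-monoˡ-< y u<x)) p
weight-decreasing {s = x , y , z , p} (move-y v<y) =
  weight-< (+-monoˡ-< z (+-monoʳ-< x v<y)) p
weight-decreasing {h} {s = x , y , z , p} (move-z {w = w} w<z) =
  weight-< (+-mono-≤-< (+-monoʳ-≤ x (m⊓n≤m y (h w))) w<z) p
weight-decreasing (pass _) = n<1+n _

IsP⇒¬IsN : ∀ {h s} → IsP h s → ¬ IsN h s
IsP⇒¬IsN (isP options) (isN move p) = IsP⇒¬IsN p (options move)

module Classification {h : ℕ → ℕ} (Good : Pos → Set)
  (no-good-option : ∀ {s t} → Legal h s → Good s → Move h s t → ¬ Good t)
  (good-option : ∀ {s} → Legal h s → ¬ Good s → Σ Pos λ t → Move h s t × Good t)
  where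

  classify : ∀ {s} → Legal h s → Acc _<_ (weight s) →
             (Good s → IsP h s) × (¬ Good s → IsN h s)
  classify {s} legal (acc smaller) = Good⇒IsP , ¬Good⇒IsN
    where
    classify-option : ∀ {t} → Move h s t → (Good t → IsP h t) × (¬ Good t → IsN h t)
    classify-option move =
      classify (Legal-closed move legal) (smaller (weight-decreasing move))
    Good⇒IsP : Good s → IsP h s
    Good⇒IsP good = isP λ move → proj₂ (classify-option move) (no-good-option legal good move)
    ¬Good⇒IsN : ¬ Good s → IsN h s
    ¬Good⇒IsN bad with good-option legal bad
    ... | t , move , good = isN move (proj₁ (classify-option move) good)

  Good⇔IsP : ∀ {s} → Legal h s → Dec (Good s) → Good s ⇔ IsP h s
  Good⇔IsP {s} legal good? =
    mk⇔ (proj₁ classified)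
        (λ p → decidable-stable good? (λ bad → IsP⇒¬IsN p (proj₂ classified bad)))
    where
    classified : (Good s → IsP h s) × (¬ Good s → IsN h s)
    classified = classify legal (<-wellFounded (weight s))

-- twin n = n ⊕ 1.  With x = suc n, the sets A₁ and A₂ are exactly the positions
-- with suc (twin n) ⊕ y ⊕ z = 0.
twin : ℕ → ℕ
twin 0             = 1
twin 1             = 0
twin (suc (suc n)) = suc (suc (twin n))

twin-involutive : ∀ n → twin (twin n) ≡ n
twin-involutive 0             = refl
twin-involutive 1             = refl
twin-involutive (suc (suc n)) = cong (suc ∘ suc) (twin-involutive n)

twin-injective : ∀ {m n} → twin m ≡ twin n → m ≡ n
twin-injective {m} {n} eq =
  trans (sym (twin-involutive m)) (trans (cong twin eq) (twin-involutive n))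

twin-≢ : ∀ n → twin n ≢ n
twin-≢ 0             ()
twin-≢ 1             ()
twin-≢ (suc (suc n)) eq = twin-≢ n (suc-injective (suc-injective eq))

twin-< : ∀ {u x} → u < twin x → u ≢ x → twin u < x
twin-< {zero}        {zero}        _             u≢x = ⊥-elim (u≢x refl)
twin-< {suc _}       {zero}        (s≤s ())      _
twin-< {_}           {1}           ()            _
twin-< {zero}        {suc (suc _)} _             _   = s≤s (s≤s z≤n)
twin-< {1}           {suc (suc _)} _             _   = s≤s z≤n
twin-< {suc (suc u)} {suc (suc x)} (s≤s (s≤s u<twin)) u≢x =
  s≤s (s≤s (twin-< u<twin (u≢x ∘ cong (suc ∘ suc))))

suc-twin-odd : ∀ n → suc n % 2 ≡ 1 → suc (twin n) ≡ suc n + 1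
suc-twin-odd 0             _   = refl
suc-twin-odd 1             ()
suc-twin-odd (suc (suc n)) odd = cong (suc ∘ suc) (suc-twin-odd n odd)

suc-twin-even : ∀ n → suc n % 2 ≡ 0 → suc (twin n) ≡ n
suc-twin-even 0             ()
suc-twin-even 1             _    = refl
suc-twin-even (suc (suc n)) even = cong (suc ∘ suc) (suc-twin-even n even)

2≤-even-suc : ∀ n → suc n % 2 ≡ 0 → 2 ≤ suc n
2≤-even-suc 0       ()
2≤-even-suc (suc n) _ = s≤s (s≤s z≤n)

Good : Pos → Set
Good (x , y , z , false)     = x ⊕ y ≡ z
Good (zero , y , z , true)   = y ≡ 0 × z ≡ 0
Good (suc n , y , z , true)  = suc (twin n) ⊕ y ≡ z

Good? : ∀ s → Dec (Good s)
Good? (x , y , z , false)    = x ⊕ y ≟ z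
Good? (zero , y , z , true)  = (y ≟ 0) ×-dec (z ≟ 0)
Good? (suc n , y , z , true) = suc (twin n) ⊕ y ≟ z

InA⇒Good : ∀ {h s} → InA h s → Good s
InA⇒Good (inA₀ x⊕y⊕z≡0 _)                    = m⊕n≡0⇒m≡n x⊕y⊕z≡0
InA⇒Good (inA₁ {zero} () _ _)
InA⇒Good (inA₁ {suc n} {y} {z} odd eq _)     =
  subst (λ t → t ⊕ y ≡ z) (sym (suc-twin-odd n odd)) (m⊕n≡0⇒m≡n eq)
InA⇒Good (inA₂ {zero} () _ _ _)
InA⇒Good (inA₂ {suc n} {y} {z} _ even eq _)  =
  subst (λ t → t ⊕ y ≡ z) (sym (suc-twin-even n even)) (m⊕n≡0⇒m≡n eq)
InA⇒Good inA₃                                = refl , refl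

Good⇒InA : ∀ {h} x y z p → y ≤ h z → Good (x , y , z , p) → InA h (x , y , z , p)
Good⇒InA x       y z false y≤hz good          = inA₀ (m≡n⇒m⊕n≡0 good) y≤hz
Good⇒InA zero    _ _ true  _    (refl , refl) = inA₃
Good⇒InA (suc n) y z true  y≤hz good with parity (suc n)
... | inj₂ odd  = inA₁ odd (m≡n⇒m⊕n≡0 (subst (λ t → t ⊕ y ≡ z) (suc-twin-odd n odd) good)) y≤hz
... | inj₁ even = inA₂ (2≤-even-suc n even) even
                       (m≡n⇒m⊕n≡0 (subst (λ t → t ⊕ y ≡ z) (suc-twin-even n even) good)) y≤hz

InA⇔Good : ∀ {h} x y z p → y ≤ h z → InA h (x , y , z , p) ⇔ Good (x , y , z , p)
InA⇔Good x y z p y≤hz = mk⇔ InA⇒Good (Good⇒InA x y z p y≤hz)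

module NSGame (h : ℕ → ℕ) (h0≡0 : h 0 ≡ 0) (h-contracting : Contracting h) where

  h[z]<z : ∀ {z} → 0 < z → h z < z
  h[z]<z {z} 0<z with highest-diff (λ z≡0 → <⇒≢ 0<z (sym z≡0))
  ... | j , above , differ = <-≤-trans h[z]<2^j 2^j≤z
    where
    h[z]<2^j : h z < 2 ^ j
    h[z]<2^j = m/n≡0⇒m<n {{m^n≢0 2 j}}
      (trans (h-contracting z 0 j above) (trans (cong (_/2^ j) h0≡0) (0/2^ j)))
    2^j≤z : 2 ^ j ≤ z
    2^j≤z = m/n≢0⇒n≤m {{m^n≢0 2 j}}
      (λ z/2^j≡0 → differ (trans (cong (_% 2) z/2^j≡0) (sym (bit-zero j))))

  y≤h[y]⇒y≡0 : ∀ {y} → y ≤ h y → y ≡ 0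
  y≤h[y]⇒y≡0 {zero}  _     = refl
  y≤h[y]⇒y≡0 {suc y} y≤hy = ⊥-elim (<⇒≱ (h[z]<z (s≤s z≤n)) y≤hy)

  -- Moving z to w from (a, y, z) reaches a zero position of the game without
  -- pass exactly when w is a fixed point of zTarget a y.
  zTarget : ℕ → ℕ → ℕ → ℕ
  zTarget a y w = a ⊕ (y ⊓ h w)

  zTarget-contracting : ∀ a y → Contracting (zTarget a y)
  zTarget-contracting a y w w′ j above = begin
    (a ⊕ (y ⊓ h w)) /2^ j                  ≡⟨ ⊕-/2^ j a (y ⊓ h w) ⟩
    a /2^ j ⊕ (y ⊓ h w) /2^ j              ≡⟨ cong (a /2^ j ⊕_) (/2^-distrib-⊓ j y (h w)) ⟩
    a /2^ j ⊕ ((y /2^ j) ⊓ (h w /2^ j))    ≡⟨ cong (λ t → a /2^ j ⊕ ((y /2^ j) ⊓ t))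
                                                   (h-contracting w w′ j above) ⟩
    a /2^ j ⊕ ((y /2^ j) ⊓ (h w′ /2^ j))   ≡⟨ cong (a /2^ j ⊕_) (/2^-distrib-⊓ j y (h w′)) ⟨
    a /2^ j ⊕ (y ⊓ h w′) /2^ j             ≡⟨ ⊕-/2^ j a (y ⊓ h w′) ⟨
    (a ⊕ (y ⊓ h w′)) /2^ j                 ∎
    where open ≡-Reasoning

  zTarget-/2^ : ∀ a {y z w} j → y ≤ h z → w /2^ suc j ≡ z /2^ suc j →
                zTarget a y w /2^ j ≡ (a ⊕ y) /2^ j
  zTarget-/2^ a {y} {z} {w} j y≤hz above =
    trans (zTarget-contracting a y w z j above)
          (cong (λ t → (a ⊕ t) /2^ j) (m≤n⇒m⊓n≡m y≤hz))

  zTarget-fixpoint-unique : ∀ a {y z w} → y ≤ h z → a ⊕ y ≡ z → zTarget a y w ≡ w → w ≡ z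
  zTarget-fixpoint-unique a {y} {z} {w} y≤hz a⊕y≡z fixed with w ≟ z
  ... | yes w≡z = w≡z
  ... | no  w≢z with highest-diff w≢z
  ...   | j , above , differ = ⊥-elim (differ (cong (_% 2) w/2^j≡z/2^j))
    where
    open ≡-Reasoning
    w/2^j≡z/2^j : w /2^ j ≡ z /2^ j
    w/2^j≡z/2^j = begin
      w /2^ j              ≡⟨ cong (_/2^ j) fixed ⟨
      zTarget a y w /2^ j  ≡⟨ zTarget-/2^ a j y≤hz above ⟩
      (a ⊕ y) /2^ j        ≡⟨ cong (_/2^ j) a⊕y≡z ⟩
      z /2^ j              ∎

  below-fixpoint : ∀ a {y z w} → y ≤ h z → zTarget a y w ≡ w → z < w → z < a ⊕ y
  below-fixpoint a {y} {z} {w} y≤hz fixed z<w with highest-diff-< z<w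
  ... | j , above , z0 , w1 = agree-above-< j z≈a⊕y z0 (trans (cong (_% 2) (sym w≈a⊕y)) w1)
    where
    open ≡-Reasoning
    w≈a⊕y : w /2^ j ≡ (a ⊕ y) /2^ j
    w≈a⊕y = trans (cong (_/2^ j) (sym fixed)) (zTarget-/2^ a j y≤hz (sym above))
    z≈a⊕y : z /2^ suc j ≡ (a ⊕ y) /2^ suc j
    z≈a⊕y = begin
      z /2^ suc j          ≡⟨ above ⟩
      w /2^ suc j          ≡⟨ /2^-sucʳ w j ⟩
      w /2^ j / 2          ≡⟨ cong (_/ 2) w≈a⊕y ⟩
      (a ⊕ y) /2^ j / 2    ≡⟨ /2^-sucʳ (a ⊕ y) j ⟨
      (a ⊕ y) /2^ suc j    ∎

  data ZeroOption (a y z : ℕ) : Set where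
    via-x : ∀ {u} → u < a → u ⊕ y ≡ z → ZeroOption a y z
    via-y : ∀ {v} → v < y → a ⊕ v ≡ z → ZeroOption a y z
    via-z : ∀ {w} → w < z → zTarget a y w ≡ w → ZeroOption a y z

  -- Implicit arguments below are passed explicitly: ⊕ is not injective, and
  -- leaving them to unification makes Agda unfold ⊕ and exhaust memory.
  zero-option : ∀ a y z → y ≤ h z → a ⊕ y ≢ z → ZeroOption a y z
  zero-option a y z y≤hz a⊕y≢z with contracting-fixpoint {zTarget a y} (zTarget-contracting a y)
  ... | w , fixed with <-cmp w z
  ...   | tri< w<z _ _ = via-z w<z fixed
  ...   | tri≈ _ refl _ = ⊥-elim (a⊕y≢z (trans (cong (a ⊕_) (sym (m≤n⇒m⊓n≡m y≤hz))) fixed))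
  ...   | tri> _ _ z<w = nim-option (nim-move {a} {y} (below-fixpoint a {y} {z} {w} y≤hz fixed z<w))
    where
    nim-option : (Σ ℕ λ u → u < a × u ⊕ y ≡ z) ⊎ (Σ ℕ λ v → v < y × a ⊕ v ≡ z) → ZeroOption a y z
    nim-option (inj₁ (_ , u<a , u⊕y≡z)) = via-x u<a u⊕y≡z
    nim-option (inj₂ (_ , v<y , a⊕v≡z)) = via-y v<y a⊕v≡z

  no-good-option : ∀ {s t} → Legal h s → Good s → Move h s t → ¬ Good t
  no-good-option {x , y , z , false} _ good (move-x u<x) good′ =
    <⇒≢ u<x (⊕-cancelʳ y (trans good′ (sym good)))
  no-good-option {x , y , z , false} _ good (move-y v<y) good′ =
    <⇒≢ v<y (⊕-cancelˡ x (trans good′ (sym good)))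
  no-good-option {x , y , z , false} y≤hz good (move-z w<z) good′ =
    <⇒≢ w<z (zTarget-fixpoint-unique x y≤hz good good′)
  no-good-option {zero , _ , _ , true} _ (refl , _) (move-y ())
  no-good-option {zero , _ , _ , true} _ (_ , refl) (move-z ())
  no-good-option {zero , _ , _ , true} _ (refl , refl) (pass nonzero) _ =
    nonzero (refl , refl , refl)
  no-good-option {suc n , _ , _ , true} _ good (move-x {u = zero} _) (refl , refl) =
    0≢1+n (trans (sym good) (⊕-identityʳ (suc (twin n))))
  no-good-option {suc n , y , _ , true} _ good (move-x {u = suc u} (s≤s u<n)) good′ =
    <⇒≢ u<n (twin-injective (suc-injective (⊕-cancelʳ y (trans good′ (sym good)))))
  no-good-option {suc n , y , _ , true} _ good (move-y v<y) good′ =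
    <⇒≢ v<y (⊕-cancelˡ (suc (twin n)) (trans good′ (sym good)))
  no-good-option {suc n , _ , _ , true} y≤hz good (move-z w<z) good′ =
    <⇒≢ w<z (zTarget-fixpoint-unique (suc (twin n)) y≤hz good good′)
  no-good-option {suc n , y , _ , true} _ good (pass _) good′ =
    twin-≢ n (suc-injective (⊕-cancelʳ y (trans good (sym good′))))

  good-option : ∀ {s} → Legal h s → ¬ Good s → Σ Pos λ t → Move h s t × Good t
  good-option {x , y , z , false} y≤hz bad with zero-option x y z y≤hz bad
  ... | via-x u<x good = _ , move-x u<x , good
  ... | via-y v<y good = _ , move-y v<y , good
  ... | via-z w<z good = _ , move-z w<z , good
  good-option {zero , y , zero , true} y≤h0 bad =
    ⊥-elim (bad (n≤0⇒n≡0 (subst (y ≤_) h0≡0 y≤h0) , refl))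
  good-option {zero , y , suc z , true} _ _ =
    _ , move-z (s≤s z≤n) , n≤0⇒n≡0 (subst (y ⊓ h 0 ≤_) h0≡0 (m⊓n≤n y (h 0))) , refl
  good-option {suc n , y , z , true} y≤hz bad with zero-option (suc (twin n)) y z y≤hz bad
  ... | via-y v<y good = _ , move-y v<y , good
  ... | via-z w<z good = _ , move-z w<z , good
  ... | via-x {zero} _ 0⊕y≡z with trans (sym (⊕-identityˡ y)) 0⊕y≡z
  ...   | refl = _ , move-x (s≤s z≤n) , y≡0 , y≡0
    where
    y≡0 : y ≡ 0
    y≡0 = y≤h[y]⇒y≡0 y≤hz
  good-option {suc n , y , z , true} y≤hz bad | via-x {suc u} (s≤s u<twin) good with u ≟ n
  ...   | yes refl = _ , pass (λ ()) , good
  ...   | no  u≢n  = _ , move-x (s≤s (twin-< u<twin u≢n)) ,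
                     subst (λ t → suc t ⊕ y ≡ z) (sym (twin-involutive u)) good

  open Classification Good no-good-option good-option public

corollary2 : (h : ℕ → ℕ) → Monotone h → NSProperty h →
    (x y z : ℕ) (p : Bool) → y ≤ h z →
    (InA h (x , y , z , p) ⇔ IsP h (x , y , z , p))
corollary2 h _ (h0≡0 , h-contracting) x y z p y≤hz =
  Good⇔IsP y≤hz (Good? (x , y , z , p)) ⇔-∘ InA⇔Good x y z p y≤hz
  where open NSGame h h0≡0 h-contracting
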